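{- Let $S_1,\ldots,S_n\in\mathcal{R}_\pi^\times$ with $S_1\subseteq S_2\subseteq\cdots\subseteq S_n$. Then \[\int h_{S_1}h_{S_2}\cdots h_{S_n}=\begin{cases}1&\text{if }|S_i|\ge i\text{ for all }i\in[n],\\ 0&\text{otherwise.}\end{cases}\]
   Context: Uniform setting: $r\ge2$, $E=\bigsqcup_{i=1}^nE_i$ with $E_i=\{i^0,\ldots,i^{r-1}\}$. A subset is colored if it meets each $E_i$ in at most one element; $\mathcal{R}_\pi^\times$ is the set of nonempty colored subsets. $A^*(\Sigma^\pi)=\mathbb{Z}[x_S:S\in\mathcal{R}_\pi^\times]/(\mathcal{I}+\mathcal{J})$ with $\mathcal{I}$ generated by $x_Sx_{S'}$ for incomparable $S,S'$ and $\mathcal{J}$ by $\sum_{S\ni e}x_S-\sum_{S\ni e'}x_S$ for distinct $e,e'$ in a common block; $h_U=\sum_{S'\in\mathcal{R}_\pi^\times,\,S'\cap U\ne\emptyset}x_{S'}$. The integral is the degree map, the linear map on degree-$n$ elements with $\int x_{T_1}\cdots x_{T_n}=1$ for each chain $T_1\subsetneq\cdots\subsetneq T_n$ in $\mathcal{R}_\pi^\times$. (The paper phrases this as an integral over the moduli space $\overline{\mathcal{L}}^r_n$, whose Chow ring it identifies with $A^*(\Sigma^\pi)$ compatibly with degrees.) -}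

module Defs where

open import Data.Nat using (ℕ; zero; suc; _≤_; _∸_)
open import Data.Bool using (Bool; true; false; T; _∧_; _∨_; if_then_else_)
open import Data.Unit using (tt)
open import Data.Fin using (Fin; toℕ)
open import Data.Fin.Properties using () renaming (_≟_ to _≟ᶠ_)
open import Data.Maybe using (Maybe; just; nothing)
open import Data.Vec using (Vec; []; _∷_; lookup; toList)
open import Data.List using (List; []; _∷_; [_]; map; concatMap; mapMaybe; filterᵇ; length; allFin)
open import Data.List.Relation.Binary.Permutation.Propositional using (_↭_)
open import Data.Integer using (ℤ; _+_; 0ℤ; 1ℤ)
open import Data.Product using (Σ; _,_; proj₁; _×_)
open import Relation.Nullary using (¬_; does)
open import Relation.Binary.PropositionalEquality using (_≡_; refl; sym; subst; _≢_)

-- A colored subset of E = ⊔_{i<n} E_i, E_i = {i^0,…,i^{r-1}}, is recorded as a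
-- vector S with  lookup S i = just c  iff  i^c ∈ S, and nothing iff S ∩ E_i = ∅.
Colored : ℕ → ℕ → Set
Colored n r = Vec (Maybe (Fin r)) n

size : ∀ {n r} → Colored n r → ℕ
size [] = 0
size (nothing ∷ v) = size v
size (just _ ∷ v) = suc (size v)

nonempty : ∀ {n r} → Colored n r → Bool
nonempty [] = false
nonempty (nothing ∷ v) = nonempty v
nonempty (just _ ∷ v) = true

-- R_π^× : nonempty colored subsets (the proof component is T b, definitionally unique)
Gen : ℕ → ℕ → Set
Gen n r = Σ (Colored n r) (λ v → T (nonempty v))

_∋[_,_] : ∀ {n r} → Gen n r → Fin n → Fin r → Set
S ∋[ i , c ] = lookup (proj₁ S) i ≡ just c

_⊆ᶜ_ : ∀ {n r} → Gen n r → Gen n r → Set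
_⊆ᶜ_ {n} {r} S S' = (i : Fin n) (c : Fin r) → S ∋[ i , c ] → S' ∋[ i , c ]

_⊊ᶜ_ : ∀ {n r} → Gen n r → Gen n r → Set
S ⊊ᶜ S' = S ⊆ᶜ S' × ¬ (S' ⊆ᶜ S)

Incomparable : ∀ {n r} → Gen n r → Gen n r → Set
Incomparable S S' = ¬ (S ⊆ᶜ S') × ¬ (S' ⊆ᶜ S)

allColored : (n r : ℕ) → List (Colored n r)
allColored zero r = [ [] ]
allColored (suc n) r =
  concatMap (λ m → map (m ∷_) (allColored n r)) (nothing ∷ map just (allFin r))

mkGen : ∀ {n r} (v : Colored n r) (b : Bool) → nonempty v ≡ b → Maybe (Gen n r)
mkGen v true eq = just (v , subst T (sym eq) tt)
mkGen v false eq = nothing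

allGens : (n r : ℕ) → List (Gen n r)
allGens n r = mapMaybe (λ v → mkGen v (nonempty v) refl) (allColored n r)

sameColor : ∀ {r} → Maybe (Fin r) → Maybe (Fin r) → Bool
sameColor (just a) (just b) = does (a ≟ᶠ b)
sameColor _ _ = false

meets : ∀ {n r} → Colored n r → Colored n r → Bool
meets [] [] = false
meets (a ∷ u) (b ∷ v) = sameColor a b ∨ meets u v

-- the list of variables occurring in h_U = Σ_{S' ∩ U ≠ ∅} x_{S'}
hTerms : ∀ {n r} → Gen n r → List (Gen n r)
hTerms {n} {r} U = filterᵇ (λ S' → meets (proj₁ U) (proj₁ S')) (allGens n r)

containing : ∀ {n r} → Fin n → Fin r → List (Gen n r)
containing {n} {r} i c = filterᵇ (λ S → sameColor (lookup (proj₁ S) i) (just c)) (allGens n r)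

sumℤ : List ℤ → ℤ
sumℤ [] = 0ℤ
sumℤ (x ∷ xs) = x + sumℤ xs

-- cartesian product: expansion of a product of sums of variables into monomials
cartesian : ∀ {A : Set} → List (List A) → List (List A)
cartesian [] = [ [] ]
cartesian (xs ∷ xss) = concatMap (λ x → map (x ∷_) (cartesian xss)) xs

-- A ℤ-linear map on the degree-n part of ℤ[x_S : S ∈ R_π^×] is given by its
-- values φ m on monomials m (lists of variables of length n, order irrelevant).
-- It is the degree map ∫ of A*(Σ^π) iff it vanishes on the degree-n part of
-- I + J (spanned by monomial multiples of the homogeneous generators) and
-- takes value 1 on every chain monomial x_{T₁}⋯x_{Tₙ}, T₁ ⊊ ⋯ ⊊ Tₙ.
record IsDegreeMap (n r : ℕ) (φ : List (Gen n r) → ℤ) : Set where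
  field
    symmetric : (m m' : List (Gen n r)) → length m ≡ n → m ↭ m' → φ m ≡ φ m'
    vanish-I  : (S S' : Gen n r) (m : List (Gen n r)) →
                suc (suc (length m)) ≡ n → Incomparable S S' → φ (S ∷ S' ∷ m) ≡ 0ℤ
    vanish-J  : (m : List (Gen n r)) → suc (length m) ≡ n →
                (i : Fin n) (a b : Fin r) → a ≢ b →
                sumℤ (map (λ S → φ (S ∷ m)) (containing i a))
                  ≡ sumℤ (map (λ S → φ (S ∷ m)) (containing i b))
    chain-one : (Ts : Vec (Gen n r) n) →
                ((k k' : Fin n) → toℕ k' ≡ suc (toℕ k) → lookup Ts k ⊊ᶜ lookup Ts k') →
                φ (toList Ts) ≡ 1ℤ

∫h : ∀ {n r} → (List (Gen n r) → ℤ) → List (Gen n r) → ℤ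
∫h φ Us = sumℤ (map φ (cartesian (map hTerms Us)))

{-# OPTIONS --safe #-}
module Submission where

-- Expand the product and read each monomial from the left: the variable x_L taken from the
-- current factor is the smallest element of the chain chosen so far. If i^c ∈ U ∩ L, the next
-- factor h_U may be replaced, modulo I + J, by the sum of the x_S with S ⊆ L ∖ {i^c} meeting U:
-- by J the terms with i^c ∈ S can be traded for those with i^{c'} ∈ S for some c' ≠ c (here
-- r ≥ 2 is used), and these, as well as the terms with i^c ∉ S ⊈ L, are incomparable to L and
-- vanish by I. By induction, for a chain monomial whose smallest variable is x_L,
--   ∫ x_L ⋯ h_{U₁} ⋯ h_{Uₖ} = 1 if |L| = k + 1 and |Uⱼ ∩ L| ≥ j + 1 for all j, and 0 otherwise,
-- because only S = L ∖ {i^c} can satisfy these size conditions. For the first factor h_{S₁}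
-- the condition |Sₙ ∩ L| ≥ n forces L = Sₙ, and then the conditions read |Sⱼ| ≥ j.

open import Defs
open import Data.Bool using (Bool; true; false; T; _∧_; if_then_else_)
open import Data.Bool.Properties using (T-∧; T-≡; T-irrelevant)
open import Data.Empty using (⊥-elim)
open import Data.Fin using (Fin; toℕ; zero; suc)
import Data.Fin.Properties as Fin
open import Data.Integer using (ℤ; 0ℤ; 1ℤ; _+_)
open import Data.Integer.Properties using (+-identityˡ; +-identityʳ; +-assoc; +-commutativeSemigroup)
open import Algebra.Properties.CommutativeSemigroup +-commutativeSemigroup using (interchange)
open import Data.List
  using (List; []; _∷_; [_]; map; concatMap; mapMaybe; filterᵇ; length; allFin; _++_; _ʳ++_; reverse)
import Data.List.Properties as List
open import Data.List.Relation.Binary.Permutation.Propositional using (_↭_; ↭-sym; ↭-trans; prep)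
open import Data.List.Relation.Binary.Permutation.Propositional.Properties using (shift; ++↭ʳ++; ↭-reverse)
open import Data.List.Relation.Unary.All using (All; []; _∷_)
import Data.List.Relation.Unary.All as All
open import Data.List.Relation.Unary.Linked using (Linked; []; [-]; _∷_)
import Data.List.Relation.Unary.Linked as Linked
open import Data.List.Relation.Unary.Linked.Properties using (Linked⇒All)
open import Data.Maybe using (Maybe; just; nothing; maybe)
open import Data.Maybe.Properties using (just-injective) renaming (≡-dec to ≡-decᵐ)
import Data.Nat as Nat
open import Data.Nat using (ℕ; zero; suc; _≤_; z≤n; s≤s; _≟_; _≤?_)
import Data.Nat.Properties as ℕ
open import Data.Product using (Σ-syntax; ∃₂; _,_; proj₁; proj₂; _×_)
open import Data.Unit using (⊤; tt)
open import Data.Vec using (Vec; []; _∷_; lookup; toList; fromList; _[_]≔_)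
open import Data.Vec.Properties
  using (lookup∘update; lookup∘update′; toList∘fromList; length-toList; ∷-injectiveˡ; ∷-injectiveʳ)
open import Function using (_∘_; id; case_of_)
open import Function.Bundles using (Equivalence)
open import Relation.Binary.Definitions using (Reflexive; Transitive)
open import Relation.Binary.PropositionalEquality hiding ([_])
open import Relation.Nullary using (¬_; Dec; yes; no)
import Relation.Nullary.Decidable as Dec
open import Relation.Nullary.Decidable using (⌊_⌋; _×-dec_)

private variable
  A B : Set

-- Sums over lists

∑ : List A → (A → ℤ) → ℤ
∑ xs f = sumℤ (map f xs)

syntax ∑ xs (λ x → e) = ∑[ x ∈ xs ] e

∑-cong : (xs : List A) {f g : A → ℤ} → (∀ x → f x ≡ g x) → ∑ xs f ≡ ∑ xs g
∑-cong []       f≗g = refl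
∑-cong (x ∷ xs) f≗g = cong₂ _+_ (f≗g x) (∑-cong xs f≗g)

∑-zero : (xs : List A) {f : A → ℤ} → (∀ x → f x ≡ 0ℤ) → ∑ xs f ≡ 0ℤ
∑-zero []       f≗0 = refl
∑-zero (x ∷ xs) f≗0 = cong₂ _+_ (f≗0 x) (∑-zero xs f≗0)

∑-distrib-+ : (xs : List A) (f g : A → ℤ) → ∑[ x ∈ xs ] (f x + g x) ≡ ∑ xs f + ∑ xs g
∑-distrib-+ []       f g = refl
∑-distrib-+ (x ∷ xs) f g =
  trans (cong (f x + g x +_) (∑-distrib-+ xs f g))
        (interchange (f x) (g x) (∑ xs f) (∑ xs g))

∑-++ : (xs ys : List A) (f : A → ℤ) → ∑ (xs ++ ys) f ≡ ∑ xs f + ∑ ys f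
∑-++ []       ys f = sym (+-identityˡ _)
∑-++ (x ∷ xs) ys f = trans (cong (f x +_) (∑-++ xs ys f)) (sym (+-assoc (f x) _ _))

∑-concatMap : (xs : List A) (g : A → List B) (f : B → ℤ) →
              ∑ (concatMap g xs) f ≡ ∑[ x ∈ xs ] ∑ (g x) f
∑-concatMap []       g f = refl
∑-concatMap (x ∷ xs) g f =
  trans (∑-++ (g x) (concatMap g xs) f) (cong (∑ (g x) f +_) (∑-concatMap xs g f))

∑-map : (xs : List A) (g : A → B) (f : B → ℤ) → ∑ (map g xs) f ≡ ∑ xs (f ∘ g)
∑-map xs g f = cong sumℤ (sym (List.map-∘ xs))

∑-filterᵇ : (p : A → Bool) (xs : List A) (f : A → ℤ) →
            ∑ (filterᵇ p xs) f ≡ ∑[ x ∈ xs ] (if p x then f x else 0ℤ)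
∑-filterᵇ p []       f = refl
∑-filterᵇ p (x ∷ xs) f with p x
... | true  = cong (f x +_) (∑-filterᵇ p xs f)
... | false = trans (∑-filterᵇ p xs f) (sym (+-identityˡ _))

∑-filterᵇ-cong : (p : A → Bool) (xs : List A) {f g : A → ℤ} →
                 (∀ x → T (p x) → f x ≡ g x) → ∑ (filterᵇ p xs) f ≡ ∑ (filterᵇ p xs) g
∑-filterᵇ-cong p []       f≗g = refl
∑-filterᵇ-cong p (x ∷ xs) f≗g with p x in px
... | true  = cong₂ _+_ (f≗g x (Equivalence.from T-≡ px)) (∑-filterᵇ-cong p xs f≗g)
... | false = ∑-filterᵇ-cong p xs f≗g

∑-mapMaybe : (g : A → Maybe B) (xs : List A) (f : B → ℤ) →
             ∑ (mapMaybe g xs) f ≡ ∑[ x ∈ xs ] maybe f 0ℤ (g x)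
∑-mapMaybe g []       f = refl
∑-mapMaybe g (x ∷ xs) f with g x
... | just y  = cong (f y +_) (∑-mapMaybe g xs f)
... | nothing = trans (∑-mapMaybe g xs f) (sym (+-identityˡ _))

∑-comm : (xs : List A) (ys : List B) (g : A → B → ℤ) →
         ∑[ x ∈ xs ] ∑ ys (g x) ≡ ∑[ y ∈ ys ] ∑[ x ∈ xs ] g x y
∑-comm []       ys g = sym (∑-zero ys (λ _ → refl))
∑-comm (x ∷ xs) ys g =
  trans (cong (∑ ys (g x) +_) (∑-comm xs ys g)) (sym (∑-distrib-+ ys (g x) _))

∑-cartesian-∷ : (xs : List A) (xss : List (List A)) (f : List A → ℤ) →
                ∑ (cartesian (xs ∷ xss)) f ≡ ∑[ x ∈ xs ] ∑[ m ∈ cartesian xss ] f (x ∷ m)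
∑-cartesian-∷ xs xss f =
  trans (∑-concatMap xs _ f) (∑-cong xs (λ x → ∑-map (cartesian xss) (x ∷_) f))

∑-cartesian-cong : (xss : List (List A)) {f g : List A → ℤ} →
                   (∀ m → length m ≡ length xss → f m ≡ g m) →
                   ∑ (cartesian xss) f ≡ ∑ (cartesian xss) g
∑-cartesian-cong []         f≗g = cong (_+ 0ℤ) (f≗g [] refl)
∑-cartesian-cong (xs ∷ xss) {f} {g} f≗g = begin
  ∑ (cartesian (xs ∷ xss)) f                    ≡⟨ ∑-cartesian-∷ xs xss f ⟩
  ∑[ x ∈ xs ] ∑[ m ∈ cartesian xss ] f (x ∷ m)  ≡⟨ ∑-cong xs (λ x → ∑-cartesian-cong xss (f≗g-∷ x)) ⟩
  ∑[ x ∈ xs ] ∑[ m ∈ cartesian xss ] g (x ∷ m)  ≡⟨ sym (∑-cartesian-∷ xs xss g) ⟩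
  ∑ (cartesian (xs ∷ xss)) g                    ∎
  where
  open ≡-Reasoning
  f≗g-∷ : ∀ x m → length m ≡ length xss → f (x ∷ m) ≡ g (x ∷ m)
  f≗g-∷ x m ∣m∣ = f≗g (x ∷ m) (cong suc ∣m∣)

∑-allFin-suc : ∀ r (f : Fin (suc r) → ℤ) → ∑ (allFin (suc r)) f ≡ f zero + ∑ (allFin r) (f ∘ suc)
∑-allFin-suc r f = cong (f zero +_) (cong sumℤ
  (trans (List.map-tabulate suc f) (sym (List.map-tabulate id (f ∘ suc)))))

∑-allFin-point : ∀ r (f : Fin r → ℤ) (a : Fin r) →
                 (∀ b → b ≢ a → f b ≡ 0ℤ) → ∑ (allFin r) f ≡ f a
∑-allFin-point (suc r) f zero f≗0 = begin
  ∑ (allFin (suc r)) f             ≡⟨ ∑-allFin-suc r f ⟩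
  f zero + ∑ (allFin r) (f ∘ suc)  ≡⟨ cong (f zero +_) (∑-zero (allFin r) (λ b → f≗0 (suc b) (λ ()))) ⟩
  f zero + 0ℤ                      ≡⟨ +-identityʳ _ ⟩
  f zero                           ∎
  where open ≡-Reasoning
∑-allFin-point (suc r) f (suc a) f≗0 = begin
  ∑ (allFin (suc r)) f             ≡⟨ ∑-allFin-suc r f ⟩
  f zero + ∑ (allFin r) (f ∘ suc)  ≡⟨ cong (_+ ∑ (allFin r) (f ∘ suc)) (f≗0 zero (λ ())) ⟩
  0ℤ + ∑ (allFin r) (f ∘ suc)      ≡⟨ +-identityˡ _ ⟩
  ∑ (allFin r) (f ∘ suc)           ≡⟨ ∑-allFin-point r (f ∘ suc) a f∘suc≗0 ⟩
  f (suc a)                        ∎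
  where
  open ≡-Reasoning
  f∘suc≗0 : ∀ b → b ≢ a → f (suc b) ≡ 0ℤ
  f∘suc≗0 b b≢a = f≗0 (suc b) (b≢a ∘ Fin.suc-injective)

∑-allMaybeFin-point : ∀ r (f : Maybe (Fin r) → ℤ) (a : Maybe (Fin r)) →
                      (∀ b → b ≢ a → f b ≡ 0ℤ) → ∑ (nothing ∷ map just (allFin r)) f ≡ f a
∑-allMaybeFin-point r f nothing f≗0 =
  trans (cong (f nothing +_) (trans (∑-map (allFin r) just f) (∑-zero (allFin r) (λ b → f≗0 (just b) (λ ())))))
        (+-identityʳ _)
∑-allMaybeFin-point r f (just a) f≗0 =
  trans (cong₂ _+_ (f≗0 nothing (λ ())) (∑-map (allFin r) just f))
        (trans (+-identityˡ _) (∑-allFin-point r (f ∘ just) a (λ b b≢a → f≗0 (just b) (b≢a ∘ just-injective))))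

∑-allColored-suc : ∀ n r (f : Colored (suc n) r → ℤ) →
                   ∑ (allColored (suc n) r) f
                     ≡ ∑[ b ∈ nothing ∷ map just (allFin r) ] ∑[ v ∈ allColored n r ] f (b ∷ v)
∑-allColored-suc n r f =
  trans (∑-concatMap (nothing ∷ map just (allFin r)) (λ b → map (b ∷_) (allColored n r)) f)
        (∑-cong (nothing ∷ map just (allFin r)) (λ b → ∑-map (allColored n r) (b ∷_) f))

∑-allColored-point : ∀ n r (f : Colored n r → ℤ) (u : Colored n r) →
                     (∀ v → v ≢ u → f v ≡ 0ℤ) → ∑ (allColored n r) f ≡ f u
∑-allColored-point zero    r f [] f≗0 = +-identityʳ _
∑-allColored-point (suc n) r f (a ∷ u) f≗0 = begin
  ∑ (allColored (suc n) r) f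
    ≡⟨ ∑-allColored-suc n r f ⟩
  ∑[ b ∈ nothing ∷ map just (allFin r) ] ∑[ v ∈ allColored n r ] f (b ∷ v)
    ≡⟨ ∑-allMaybeFin-point r _ a (λ b b≢a →
         ∑-zero (allColored n r) (λ v → f≗0 (b ∷ v) (b≢a ∘ ∷-injectiveˡ))) ⟩
  ∑[ v ∈ allColored n r ] f (a ∷ v)
    ≡⟨ ∑-allColored-point n r (f ∘ (a ∷_)) u (λ v v≢u → f≗0 (a ∷ v) (v≢u ∘ ∷-injectiveʳ)) ⟩
  f (a ∷ u)
    ∎
  where open ≡-Reasoning

∑-allGens-point : ∀ {n r} (f : Gen n r → ℤ) (S : Gen n r) →
                  (∀ S' → proj₁ S' ≢ proj₁ S → f S' ≡ 0ℤ) → ∑ (allGens n r) f ≡ f S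
∑-allGens-point {n} {r} f (u , u≠∅) f≗0 =
  trans (∑-mapMaybe (λ v → mkGen v (nonempty v) refl) (allColored n r) f)
        (trans (∑-allColored-point n r _ u (λ v v≢u →
                  mkGen-zero v (nonempty v) refl (λ v≠∅ → f≗0 (v , v≠∅) v≢u)))
               (mkGen-at (nonempty u) refl u≠∅))
  where
  mkGen-zero : ∀ v b (eq : nonempty v ≡ b) → (∀ v≠∅ → f (v , v≠∅) ≡ 0ℤ) →
               maybe f 0ℤ (mkGen v b eq) ≡ 0ℤ
  mkGen-zero v true  eq f≡0 = f≡0 _
  mkGen-zero v false eq f≡0 = refl

  mkGen-at : ∀ b (eq : nonempty u ≡ b) (u≠∅′ : T (nonempty u)) →
             maybe f 0ℤ (mkGen u b eq) ≡ f (u , u≠∅′)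
  mkGen-at true  eq u≠∅′ = cong (λ p → f (u , p)) (T-irrelevant _ u≠∅′)
  mkGen-at false eq u≠∅′ = ⊥-elim (subst T eq u≠∅′)

-- Colored subsets

module _ {r : ℕ} where

  -- S ⊆ᶜ S' unfolds to proj₁ S ⊆ᵛ proj₁ S'; ⊆ᵛ also applies to the empty colored subset
  _⊆ᵛ_ : ∀ {n} → Colored n r → Colored n r → Set
  _⊆ᵛ_ {n} u v = (i : Fin n) (c : Fin r) → lookup u i ≡ just c → lookup v i ≡ just c

  ⊆ᵛ-refl : ∀ {n} {u : Colored n r} → u ⊆ᵛ u
  ⊆ᵛ-refl _ _ uᵢ≡c = uᵢ≡c

  ⊆ᵛ-trans : ∀ {n} {u v w : Colored n r} → u ⊆ᵛ v → v ⊆ᵛ w → u ⊆ᵛ w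
  ⊆ᵛ-trans u⊆v v⊆w i c = v⊆w i c ∘ u⊆v i c

  ⊆ᵛ-tail : ∀ {n a b} {u v : Colored n r} → (a ∷ u) ⊆ᵛ (b ∷ v) → u ⊆ᵛ v
  ⊆ᵛ-tail a∷u⊆b∷v i = a∷u⊆b∷v (suc i)

  ∷-⊆ᵛ : ∀ {n a b} {u v : Colored n r} →
         (∀ c → a ≡ just c → b ≡ just c) → u ⊆ᵛ v → (a ∷ u) ⊆ᵛ (b ∷ v)
  ∷-⊆ᵛ a⊑b u⊆v zero    = a⊑b
  ∷-⊆ᵛ a⊑b u⊆v (suc i) = u⊆v i

  _⊆ᵛ?_ : ∀ {n} (u v : Colored n r) → Dec (u ⊆ᵛ v)
  []            ⊆ᵛ? []      = yes (λ ())
  (nothing ∷ u) ⊆ᵛ? (b ∷ v) = Dec.map′ (∷-⊆ᵛ (λ _ ())) ⊆ᵛ-tail (u ⊆ᵛ? v)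
  (just a ∷ u)  ⊆ᵛ? (b ∷ v) with ≡-decᵐ Fin._≟_ b (just a)
  ... | yes refl = Dec.map′ (∷-⊆ᵛ (λ _ → id)) ⊆ᵛ-tail (u ⊆ᵛ? v)
  ... | no  b≢a  = no (λ a∷u⊆b∷v → b≢a (a∷u⊆b∷v zero a refl))

  []≔nothing-⊆ᵛ : ∀ {n} (u : Colored n r) i → (u [ i ]≔ nothing) ⊆ᵛ u
  []≔nothing-⊆ᵛ u i j c uⱼ≡c with j Fin.≟ i
  ... | yes refl = case trans (sym uⱼ≡c) (lookup∘update i u nothing) of λ ()
  ... | no  j≢i  = trans (sym (lookup∘update′ j≢i u nothing)) uⱼ≡c

  ⊆ᵛ-[]≔nothing : ∀ {n} {u v : Colored n r} {i c} → lookup v i ≡ just c → lookup u i ≢ just c →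
                  u ⊆ᵛ v → u ⊆ᵛ (v [ i ]≔ nothing)
  ⊆ᵛ-[]≔nothing {v = v} {i} vᵢ≡c uᵢ≢c u⊆v j c' uⱼ≡c' with j Fin.≟ i
  ... | yes refl = ⊥-elim (uᵢ≢c (trans uⱼ≡c' (trans (sym (u⊆v j c' uⱼ≡c')) vᵢ≡c)))
  ... | no  j≢i  = trans (lookup∘update′ j≢i v nothing) (u⊆v j c' uⱼ≡c')

  ⊆ᵛ-[]≔nothing⁻ : ∀ {n} {u v : Colored n r} {i c} → u ⊆ᵛ (v [ i ]≔ nothing) → lookup u i ≢ just c
  ⊆ᵛ-[]≔nothing⁻ {v = v} {i} u⊆v′ uᵢ≡c =
    case trans (sym (u⊆v′ i _ uᵢ≡c)) (lookup∘update i v nothing) of λ ()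

  size-[]≔nothing : ∀ {n} (u : Colored n r) i {c} → lookup u i ≡ just c →
                    size u ≡ suc (size (u [ i ]≔ nothing))
  size-[]≔nothing (just _  ∷ u) zero    uᵢ≡c = refl
  size-[]≔nothing (nothing ∷ u) (suc i) uᵢ≡c = size-[]≔nothing u i uᵢ≡c
  size-[]≔nothing (just _  ∷ u) (suc i) uᵢ≡c = cong suc (size-[]≔nothing u i uᵢ≡c)

  size≤length : ∀ {n} (u : Colored n r) → size u ≤ n
  size≤length []            = z≤n
  size≤length (nothing ∷ u) = ℕ.m≤n⇒m≤1+n (size≤length u)
  size≤length (just _  ∷ u) = s≤s (size≤length u)

  ⊆ᵛ⇒size≤ : ∀ {n} (u v : Colored n r) → u ⊆ᵛ v → size u ≤ size v
  ⊆ᵛ⇒size≤ []            []            u⊆v = z≤n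
  ⊆ᵛ⇒size≤ (nothing ∷ u) (nothing ∷ v) u⊆v = ⊆ᵛ⇒size≤ u v (⊆ᵛ-tail u⊆v)
  ⊆ᵛ⇒size≤ (nothing ∷ u) (just _  ∷ v) u⊆v = ℕ.m≤n⇒m≤1+n (⊆ᵛ⇒size≤ u v (⊆ᵛ-tail u⊆v))
  ⊆ᵛ⇒size≤ (just a  ∷ u) (b       ∷ v) u⊆v with u⊆v zero a refl
  ... | refl = s≤s (⊆ᵛ⇒size≤ u v (⊆ᵛ-tail u⊆v))

  ⊆ᵛ-size-antisym : ∀ {n} (u v : Colored n r) → u ⊆ᵛ v → size v ≤ size u → u ≡ v
  ⊆ᵛ-size-antisym []            []            u⊆v ∣v∣≤∣u∣ = refl
  ⊆ᵛ-size-antisym (nothing ∷ u) (nothing ∷ v) u⊆v ∣v∣≤∣u∣ =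
    cong (nothing ∷_) (⊆ᵛ-size-antisym u v (⊆ᵛ-tail u⊆v) ∣v∣≤∣u∣)
  ⊆ᵛ-size-antisym (nothing ∷ u) (just _  ∷ v) u⊆v ∣v∣≤∣u∣ =
    ⊥-elim (ℕ.<-irrefl refl (ℕ.≤-trans ∣v∣≤∣u∣ (⊆ᵛ⇒size≤ u v (⊆ᵛ-tail u⊆v))))
  ⊆ᵛ-size-antisym (just a  ∷ u) (b       ∷ v) u⊆v ∣v∣≤∣u∣ with u⊆v zero a refl
  ... | refl = cong (just a ∷_) (⊆ᵛ-size-antisym u v (⊆ᵛ-tail u⊆v) (ℕ.≤-pred ∣v∣≤∣u∣))

  nonempty⇒1≤size : ∀ {n} (u : Colored n r) → T (nonempty u) → 1 ≤ size u
  nonempty⇒1≤size (nothing ∷ u) u≠∅ = nonempty⇒1≤size u u≠∅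
  nonempty⇒1≤size (just _  ∷ u) u≠∅ = s≤s z≤n

  1≤size⇒nonempty : ∀ {n} (u : Colored n r) → 1 ≤ size u → T (nonempty u)
  1≤size⇒nonempty (nothing ∷ u) 1≤∣u∣ = 1≤size⇒nonempty u 1≤∣u∣
  1≤size⇒nonempty (just _  ∷ u) 1≤∣u∣ = tt

  sameColor⇒≡just : ∀ (a b : Maybe (Fin r)) → sameColor a b ≡ true →
                    Σ[ c ∈ Fin r ] a ≡ just c × b ≡ just c
  sameColor⇒≡just (just a) (just b) same with a Fin.≟ b
  ... | yes refl = a , refl , refl
  sameColor⇒≡just (just a) (just b) () | no _

  sameColor≡false⇒≢just : ∀ (a : Maybe (Fin r)) c → sameColor a (just c) ≡ false → a ≢ just c
  sameColor≡false⇒≢just .(just c) c different refl =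
    case trans (sym (Dec.dec-true (c Fin.≟ c) refl)) different of λ ()

  meets⇒common : ∀ {n} (u v : Colored n r) → T (meets u v) →
                 ∃₂ λ i c → lookup u i ≡ just c × lookup v i ≡ just c
  meets⇒common []      []      ()
  meets⇒common (a ∷ u) (b ∷ v) u∩v≠∅ with sameColor a b in same
  ... | true  = let c , a≡c , b≡c = sameColor⇒≡just a b same in zero , c , a≡c , b≡c
  ... | false = let i , c , uᵢ≡c , vᵢ≡c = meets⇒common u v u∩v≠∅ in suc i , c , uᵢ≡c , vᵢ≡c

  common⇒meets : ∀ {n} (u v : Colored n r) i {c} →
                 lookup u i ≡ just c → lookup v i ≡ just c → T (meets u v)
  common⇒meets (just c ∷ u) (just .c ∷ v) zero refl refl rewrite Dec.dec-true (c Fin.≟ c) refl = tt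
  common⇒meets (a ∷ u) (b ∷ v) (suc i) uᵢ≡c vᵢ≡c with sameColor a b
  ... | true  = tt
  ... | false = common⇒meets u v i uᵢ≡c vᵢ≡c

  meets-monoˡ : ∀ {n} (u u' v : Colored n r) → u ⊆ᵛ u' → T (meets u v) → T (meets u' v)
  meets-monoˡ u u' v u⊆u' u∩v≠∅ =
    let i , c , uᵢ≡c , vᵢ≡c = meets⇒common u v u∩v≠∅ in common⇒meets u' v i (u⊆u' i c uᵢ≡c) vᵢ≡c

  ∣_∩_∣ : ∀ {n} → Colored n r → Colored n r → ℕ
  ∣ []    ∩ []    ∣ = 0
  ∣ a ∷ u ∩ b ∷ v ∣ = if sameColor a b then suc ∣ u ∩ v ∣ else ∣ u ∩ v ∣

  meets⇒1≤∣∩∣ : ∀ {n} (u v : Colored n r) → T (meets u v) → 1 ≤ ∣ u ∩ v ∣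
  meets⇒1≤∣∩∣ []      []      ()
  meets⇒1≤∣∩∣ (a ∷ u) (b ∷ v) u∩v≠∅ with sameColor a b
  ... | true  = s≤s z≤n
  ... | false = meets⇒1≤∣∩∣ u v u∩v≠∅

  1≤∣∩∣⇒meets : ∀ {n} (u v : Colored n r) → 1 ≤ ∣ u ∩ v ∣ → T (meets u v)
  1≤∣∩∣⇒meets []      []      ()
  1≤∣∩∣⇒meets (a ∷ u) (b ∷ v) 1≤∣u∩v∣ with sameColor a b
  ... | true  = tt
  ... | false = 1≤∣∩∣⇒meets u v 1≤∣u∩v∣

  ∣∩∣-[]≔nothing : ∀ {n} (u v : Colored n r) i {c} → lookup u i ≡ just c → lookup v i ≡ just c →
                   ∣ u ∩ v ∣ ≡ suc ∣ u ∩ v [ i ]≔ nothing ∣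
  ∣∩∣-[]≔nothing (just c ∷ u) (just .c ∷ v) zero refl refl rewrite Dec.dec-true (c Fin.≟ c) refl = refl
  ∣∩∣-[]≔nothing (a ∷ u) (b ∷ v) (suc i) uᵢ≡c vᵢ≡c with sameColor a b
  ... | true  = cong suc (∣∩∣-[]≔nothing u v i uᵢ≡c vᵢ≡c)
  ... | false = ∣∩∣-[]≔nothing u v i uᵢ≡c vᵢ≡c

  ∣∩∣≤length : ∀ {n} (u v : Colored n r) → ∣ u ∩ v ∣ ≤ n
  ∣∩∣≤length []      []      = z≤n
  ∣∩∣≤length (a ∷ u) (b ∷ v) with sameColor a b
  ... | true  = s≤s (∣∩∣≤length u v)
  ... | false = ℕ.m≤n⇒m≤1+n (∣∩∣≤length u v)

  length≤∣∩∣⇒≡ : ∀ {n} (u v : Colored n r) → n ≤ ∣ u ∩ v ∣ → u ≡ v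
  length≤∣∩∣⇒≡ []      []      _ = refl
  length≤∣∩∣⇒≡ (a ∷ u) (b ∷ v) n≤∣u∩v∣ with sameColor a b in same
  ... | true  = let c , a≡c , b≡c = sameColor⇒≡just a b same
                in cong₂ _∷_ (trans a≡c (sym b≡c)) (length≤∣∩∣⇒≡ u v (ℕ.≤-pred n≤∣u∩v∣))
  ... | false = ⊥-elim (ℕ.<-irrefl refl (ℕ.≤-trans n≤∣u∩v∣ (∣∩∣≤length u v)))

  ⊆ᵛ⇒∣∩∣≡size : ∀ {n} (u v : Colored n r) → u ⊆ᵛ v → ∣ u ∩ v ∣ ≡ size u
  ⊆ᵛ⇒∣∩∣≡size []            []      u⊆v = refl
  ⊆ᵛ⇒∣∩∣≡size (nothing ∷ u) (b ∷ v) u⊆v = ⊆ᵛ⇒∣∩∣≡size u v (⊆ᵛ-tail u⊆v)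
  ⊆ᵛ⇒∣∩∣≡size (just a  ∷ u) (b ∷ v) u⊆v with u⊆v zero a refl
  ... | refl rewrite Dec.dec-true (a Fin.≟ a) refl = cong suc (⊆ᵛ⇒∣∩∣≡size u v (⊆ᵛ-tail u⊆v))

anotherColor : ∀ {r} → 2 ≤ r → (c : Fin r) → Σ[ c' ∈ Fin r ] c ≢ c'
anotherColor (s≤s (s≤s _)) zero    = suc zero , λ ()
anotherColor (s≤s (s≤s _)) (suc c) = zero , λ ()

-- Staircases

Staircase : (A → ℕ) → ℕ → List A → Set
Staircase f j []       = ⊤
Staircase f j (x ∷ xs) = j ≤ f x × Staircase f (suc j) xs

staircase? : (f : A → ℕ) (j : ℕ) (xs : List A) → Dec (Staircase f j xs)
staircase? f j []       = yes tt
staircase? f j (x ∷ xs) = (j ≤? f x) ×-dec staircase? f (suc j) xs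

staircase-cong : {f g : A → ℕ} {j : ℕ} {xs : List A} →
                 All (λ x → f x ≡ g x) xs → Staircase f j xs → Staircase g j xs
staircase-cong []             _              = tt
staircase-cong (fx≡gx ∷ f≗g) (j≤fx , steps) = subst (_ ≤_) fx≡gx j≤fx , staircase-cong f≗g steps

staircase-suc⁺ : {f g : A → ℕ} {j : ℕ} {xs : List A} →
                 All (λ x → g x ≡ suc (f x)) xs → Staircase f j xs → Staircase g (suc j) xs
staircase-suc⁺ []               _              = tt
staircase-suc⁺ (gx≡1+fx ∷ g≗1+f) (j≤fx , steps) =
  subst (_ ≤_) (sym gx≡1+fx) (s≤s j≤fx) , staircase-suc⁺ g≗1+f steps

staircase-suc⁻ : {f g : A → ℕ} {j : ℕ} {xs : List A} →
                 All (λ x → g x ≡ suc (f x)) xs → Staircase g (suc j) xs → Staircase f j xs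
staircase-suc⁻ []               _                = tt
staircase-suc⁻ (gx≡1+fx ∷ g≗1+f) (1+j≤gx , steps) =
  ℕ.≤-pred (subst (_ ≤_) gx≡1+fx 1+j≤gx) , staircase-suc⁻ g≗1+f steps

lastOf : A → List A → A
lastOf x []       = x
lastOf x (y ∷ ys) = lastOf y ys

staircase-lastOf : (f : A → ℕ) (j : ℕ) (x : A) (xs : List A) →
                   Staircase f j (x ∷ xs) → j Nat.+ length xs ≤ f (lastOf x xs)
staircase-lastOf f j x []       (j≤fx , _) = subst (_≤ f x) (sym (ℕ.+-identityʳ j)) j≤fx
staircase-lastOf f j x (y ∷ ys) (_ , steps) =
  subst (_≤ f (lastOf y ys)) (sym (ℕ.+-suc j (length ys))) (staircase-lastOf f (suc j) y ys steps)

staircase-toList⁺ : (f : A → ℕ) (j : ℕ) {m : ℕ} (v : Vec A m) →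
                    ((k : Fin m) → j Nat.+ toℕ k ≤ f (lookup v k)) → Staircase f j (toList v)
staircase-toList⁺ f j []      steps = tt
staircase-toList⁺ f j (x ∷ v) steps =
  subst (_≤ f x) (ℕ.+-identityʳ j) (steps zero) ,
  staircase-toList⁺ f (suc j) v (λ k → subst (_≤ f (lookup v k)) (ℕ.+-suc j (toℕ k)) (steps (suc k)))

staircase-toList⁻ : (f : A → ℕ) (j : ℕ) {m : ℕ} (v : Vec A m) →
                    Staircase f j (toList v) → (k : Fin m) → j Nat.+ toℕ k ≤ f (lookup v k)
staircase-toList⁻ f j (x ∷ v) (j≤fx , _)  zero    = subst (_≤ f x) (sym (ℕ.+-identityʳ j)) j≤fx
staircase-toList⁻ f j (x ∷ v) (_ , steps) (suc k) =
  subst (_≤ f (lookup v k)) (sym (ℕ.+-suc j (toℕ k))) (staircase-toList⁻ f (suc j) v steps k)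

module _ {R : A → A → Set} where

  Linked⇒All-head : Transitive R → {x : A} {xs : List A} → Linked R (x ∷ xs) → All (R x) xs
  Linked⇒All-head R-trans [-]         = []
  Linked⇒All-head R-trans (Rxy ∷ Rys) = Linked⇒All R-trans Rxy Rys

  Linked⇒All-lastOf : Reflexive R → Transitive R → {x : A} {xs : List A} →
                      Linked R (x ∷ xs) → All (λ y → R y (lastOf x xs)) (x ∷ xs)
  Linked⇒All-lastOf R-refl R-trans [-]         = R-refl ∷ []
  Linked⇒All-lastOf R-refl R-trans (Rxy ∷ Rys) with Linked⇒All-lastOf R-refl R-trans Rys
  ... | Ryz ∷ Rzs = R-trans Rxy Ryz ∷ Ryz ∷ Rzs

  Linked-toList⁺ : {m : ℕ} (v : Vec A m) →
                   ((k k' : Fin m) → toℕ k' ≡ suc (toℕ k) → R (lookup v k) (lookup v k')) →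
                   Linked R (toList v)
  Linked-toList⁺ []          R-steps = []
  Linked-toList⁺ (x ∷ [])    R-steps = [-]
  Linked-toList⁺ (x ∷ y ∷ v) R-steps =
    R-steps zero (suc zero) refl ∷
    Linked-toList⁺ (y ∷ v) (λ k k' k'≡1+k → R-steps (suc k) (suc k') (cong suc k'≡1+k))

  Linked-toList⁻ : {m : ℕ} (v : Vec A m) → Linked R (toList v) →
                   (k k' : Fin m) → toℕ k' ≡ suc (toℕ k) → R (lookup v k) (lookup v k')
  Linked-toList⁻ (x ∷ y ∷ v) (Rxy ∷ _)   zero    (suc zero) _      = Rxy
  Linked-toList⁻ (x ∷ y ∷ v) (_ ∷ steps) (suc k) (suc k')   k'≡1+k =
    Linked-toList⁻ (y ∷ v) steps k k' (ℕ.suc-injective k'≡1+k)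

toList-surjective : {m : ℕ} (xs : List A) → length xs ≡ m → Σ[ v ∈ Vec A m ] toList v ≡ xs
toList-surjective xs refl = fromList xs , toList∘fromList xs

ʳ++-∷-↭ : (xs : List A) (y : A) (ys : List A) → xs ʳ++ (y ∷ ys) ↭ y ∷ xs ʳ++ ys
ʳ++-∷-↭ xs y ys =
  ↭-trans (↭-sym (++↭ʳ++ xs (y ∷ ys))) (↭-trans (shift y xs ys) (prep y (++↭ʳ++ xs ys)))

indicator : {P : Set} → Dec P → ℤ
indicator (yes _) = 1ℤ
indicator (no  _) = 0ℤ

indicator-yes : {P : Set} (P? : Dec P) → P → indicator P? ≡ 1ℤ
indicator-yes (yes _) _ = refl
indicator-yes (no ¬p) p = ⊥-elim (¬p p)

indicator-no : {P : Set} (P? : Dec P) → ¬ P → indicator P? ≡ 0ℤ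
indicator-no (yes p) ¬p = ⊥-elim (¬p p)
indicator-no (no  _) _  = refl

-- Reducing a factor h_U against a chosen variable x_L

module _ {n r : ℕ} where

  ⊆ᶜ-refl : Reflexive (_⊆ᶜ_ {n} {r})
  ⊆ᶜ-refl {S} = ⊆ᵛ-refl {u = proj₁ S}

  ⊆ᶜ-trans : Transitive (_⊆ᶜ_ {n} {r})
  ⊆ᶜ-trans {S} {V} {W} = ⊆ᵛ-trans {u = proj₁ S} {proj₁ V} {proj₁ W}

  head⊆ᶜ-all : {S : Gen n r} {Us : List (Gen n r)} → Linked _⊆ᶜ_ (S ∷ Us) → All (S ⊆ᶜ_) Us
  head⊆ᶜ-all = Linked⇒All-head (λ {S V W} → ⊆ᶜ-trans {S} {V} {W})

  all⊆ᶜ-lastOf : {S : Gen n r} {Us : List (Gen n r)} → Linked _⊆ᶜ_ (S ∷ Us) →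
                 All (_⊆ᶜ lastOf S Us) (S ∷ Us)
  all⊆ᶜ-lastOf = Linked⇒All-lastOf (λ {S} → ⊆ᶜ-refl {S}) (λ {S V W} → ⊆ᶜ-trans {S} {V} {W})

  meets-increasing : (S V : Gen n r) (Us : List (Gen n r)) → Linked _⊆ᶜ_ (S ∷ Us) →
                     T (meets (proj₁ S) (proj₁ V)) → All (λ U → T (meets (proj₁ U) (proj₁ V))) Us
  meets-increasing S V Us S∷Us-incr S∩V≠∅ =
    All.map (λ {U} S⊆U → meets-monoˡ (proj₁ S) (proj₁ U) (proj₁ V) S⊆U S∩V≠∅) (head⊆ᶜ-all S∷Us-incr)

  ∑-allGens-indicator-unique :
    (p : Gen n r → Bool) {P : Gen n r → Set} (P? : ∀ S → Dec (P S)) {Q : Set} (Q? : Dec Q) (X : Colored n r) →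
    (∀ S → T (p S) → P S → Q × proj₁ S ≡ X) → (Q → Σ[ S ∈ Gen n r ] T (p S) × P S) →
    ∑[ S ∈ filterᵇ p (allGens n r) ] indicator (P? S) ≡ indicator Q?
  ∑-allGens-indicator-unique p {P} P? {Q} Q? X unique exists =
    trans (∑-filterᵇ p (allGens n r) _) (count Q?)
    where
    term : Gen n r → ℤ
    term S = if p S then indicator (P? S) else 0ℤ

    vanish : ∀ S → ¬ (Q × proj₁ S ≡ X) → term S ≡ 0ℤ
    vanish S ¬Q×S≡X with p S in pS | P? S
    ... | true  | yes PS = ⊥-elim (¬Q×S≡X (unique S (Equivalence.from T-≡ pS) PS))
    ... | true  | no  _  = refl
    ... | false | _      = refl

    count : Dec Q → ∑ (allGens n r) term ≡ indicator Q?
    count (no ¬q) = trans (∑-zero (allGens n r) (λ S → vanish S (¬q ∘ proj₁))) (sym (indicator-no Q? ¬q))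
    count (yes q) with exists q
    ... | S₀ , pS₀ , PS₀ =
      trans (∑-allGens-point term S₀ (λ S S≢S₀ → vanish S (λ (_ , S≡X) → S≢S₀ (trans S≡X (sym S₀≡X)))))
            (trans (at-S₀ (p S₀) pS₀) (sym (indicator-yes Q? q)))
      where
      S₀≡X : proj₁ S₀ ≡ X
      S₀≡X = proj₂ (unique S₀ pS₀ PS₀)

      at-S₀ : ∀ b → T b → (if b then indicator (P? S₀) else 0ℤ) ≡ 1ℤ
      at-S₀ true _ = indicator-yes (P? S₀) PS₀

  meetsWithin : Gen n r → Colored n r → Gen n r → Bool
  meetsWithin U X S = meets (proj₁ U) (proj₁ S) ∧ ⌊ proj₁ S ⊆ᵛ? X ⌋

  meetsWithin⁻ : ∀ U X S → T (meetsWithin U X S) → T (meets (proj₁ U) (proj₁ S)) × proj₁ S ⊆ᵛ X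
  meetsWithin⁻ U X S within with Equivalence.to (T-∧ {meets (proj₁ U) (proj₁ S)}) within
  ... | U∩S≠∅ , S⊆X = U∩S≠∅ , Dec.toWitness S⊆X

  hTermsWithin : Gen n r → Colored n r → List (Gen n r)
  hTermsWithin U X = filterᵇ (meetsWithin U X) (allGens n r)

  module _ (f : Gen n r → ℤ) (L U : Gen n r) (i : Fin n) (c : Fin r) (L∋ic : L ∋[ i , c ]) (U∋ic : U ∋[ i , c ])
           (f-incomparable : ∀ S → Incomparable S L → f S ≡ 0ℤ) where

    private
      X = proj₁ L [ i ]≔ nothing

      L⊈S : ∀ {S} → lookup (proj₁ S) i ≢ just c → ¬ (L ⊆ᶜ S)
      L⊈S Sᵢ≢c L⊆S = Sᵢ≢c (L⊆S i c L∋ic)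

    meets-split : ∀ S → (if meets (proj₁ U) (proj₁ S) then f S else 0ℤ)
                        ≡ (if meetsWithin U X S then f S else 0ℤ)
                          + (if sameColor (lookup (proj₁ S) i) (just c) then f S else 0ℤ)
    meets-split S with meets (proj₁ U) (proj₁ S) in U∩S | sameColor (lookup (proj₁ S) i) (just c) in S∋ic
    ... | false | false = refl
    ... | false | true  with sameColor⇒≡just (lookup (proj₁ S) i) (just c) S∋ic
    ...   | _ , Sᵢ≡c , refl =
      case trans (sym U∩S) (Equivalence.to T-≡ (common⇒meets (proj₁ U) (proj₁ S) i U∋ic Sᵢ≡c)) of λ ()
    meets-split S | true | true with sameColor⇒≡just (lookup (proj₁ S) i) (just c) S∋ic | proj₁ S ⊆ᵛ? X
    ...   | _ , Sᵢ≡c , refl | yes S⊆X = ⊥-elim (⊆ᵛ-[]≔nothing⁻ {u = proj₁ S} {proj₁ L} S⊆X Sᵢ≡c)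
    ...   | _ , Sᵢ≡c , refl | no  _   = sym (+-identityˡ _)
    meets-split S | true | false with proj₁ S ⊆ᵛ? X
    ...   | yes _  = sym (+-identityʳ _)
    ...   | no S⊈X = f-incomparable S (S⊈L , L⊈S {S} Sᵢ≢c)
      where
      Sᵢ≢c : lookup (proj₁ S) i ≢ just c
      Sᵢ≢c = sameColor≡false⇒≢just (lookup (proj₁ S) i) c S∋ic

      S⊈L : ¬ (S ⊆ᶜ L)
      S⊈L S⊆L = S⊈X (⊆ᵛ-[]≔nothing {u = proj₁ S} {proj₁ L} L∋ic Sᵢ≢c S⊆L)

    ∑-containing-other≡0 : ∀ c' → c ≢ c' → ∑ (containing i c') f ≡ 0ℤ
    ∑-containing-other≡0 c' c≢c' =
      trans (∑-filterᵇ-cong _ (allGens n r) incomparable) (∑-zero (containing i c') (λ _ → refl))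
      where
      incomparable : ∀ S → T (sameColor (lookup (proj₁ S) i) (just c')) → f S ≡ 0ℤ
      incomparable S S∋ic' with sameColor⇒≡just (lookup (proj₁ S) i) (just c') (Equivalence.to T-≡ S∋ic')
      ... | _ , Sᵢ≡c' , refl = f-incomparable S
        ( (λ S⊆L → c≢c' (just-injective (trans (sym L∋ic) (S⊆L i c' Sᵢ≡c'))))
        , L⊈S {S} (λ Sᵢ≡c → c≢c' (just-injective (trans (sym Sᵢ≡c) Sᵢ≡c'))))

    ∑-hTerms≡∑-hTermsWithin : 2 ≤ r → (∀ a b → a ≢ b → ∑ (containing i a) f ≡ ∑ (containing i b) f) →
                              ∑ (hTerms U) f ≡ ∑ (hTermsWithin U X) f
    ∑-hTerms≡∑-hTermsWithin 2≤r f-balanced = begin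
      ∑ (hTerms U) f
        ≡⟨ ∑-filterᵇ (meets (proj₁ U) ∘ proj₁) (allGens n r) f ⟩
      ∑[ S ∈ allGens n r ] (if meets (proj₁ U) (proj₁ S) then f S else 0ℤ)
        ≡⟨ ∑-cong (allGens n r) meets-split ⟩
      ∑[ S ∈ allGens n r ] ((if meetsWithin U X S then f S else 0ℤ) + (if ∋ic S then f S else 0ℤ))
        ≡⟨ ∑-distrib-+ (allGens n r) _ _ ⟩
      ∑[ S ∈ allGens n r ] (if meetsWithin U X S then f S else 0ℤ)
        + ∑[ S ∈ allGens n r ] (if ∋ic S then f S else 0ℤ)
        ≡⟨ sym (cong₂ _+_ (∑-filterᵇ (meetsWithin U X) (allGens n r) f) (∑-filterᵇ ∋ic (allGens n r) f)) ⟩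
      ∑ (hTermsWithin U X) f + ∑ (containing i c) f
        ≡⟨ cong (∑ (hTermsWithin U X) f +_) (trans (f-balanced c c' c≢c') (∑-containing-other≡0 c' c≢c')) ⟩
      ∑ (hTermsWithin U X) f + 0ℤ
        ≡⟨ +-identityʳ _ ⟩
      ∑ (hTermsWithin U X) f
        ∎
      where
      open ≡-Reasoning
      ∋ic : Gen n r → Bool
      ∋ic S = sameColor (lookup (proj₁ S) i) (just c)
      c' = proj₁ (anotherColor 2≤r c)
      c≢c' = proj₂ (anotherColor 2≤r c)

  Fits : Colored n r → List (Gen n r) → Set
  Fits L Us = size L ≡ suc (length Us) × Staircase (λ U → ∣ proj₁ U ∩ L ∣) 2 Us

  fits? : (L : Colored n r) (Us : List (Gen n r)) → Dec (Fits L Us)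
  fits? L Us = (size L ≟ suc (length Us)) ×-dec staircase? _ 2 Us

  ∑-hTermsWithin-fits :
    (L U : Gen n r) (i : Fin n) (c : Fin r) → L ∋[ i , c ] → U ∋[ i , c ] →
    (Us : List (Gen n r)) → Linked _⊆ᶜ_ (U ∷ Us) → size (proj₁ L) ≤ suc (suc (length Us)) →
    ∑[ S ∈ hTermsWithin U (proj₁ L [ i ]≔ nothing) ] indicator (fits? (proj₁ S) Us)
      ≡ indicator (fits? (proj₁ L) (U ∷ Us))
  ∑-hTermsWithin-fits L U i c L∋ic U∋ic Us U∷Us-incr ∣L∣≤2+k =
    ∑-allGens-indicator-unique _ (λ S → fits? (proj₁ S) Us) (fits? (proj₁ L) (U ∷ Us)) X unique exists
    where
    X = proj₁ L [ i ]≔ nothing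

    ∣L∣≡1+∣X∣ : size (proj₁ L) ≡ suc (size X)
    ∣L∣≡1+∣X∣ = size-[]≔nothing (proj₁ L) i L∋ic

    ∣X∣≤1+k : size X ≤ suc (length Us)
    ∣X∣≤1+k = ℕ.≤-pred (subst (_≤ suc (suc (length Us))) ∣L∣≡1+∣X∣ ∣L∣≤2+k)

    ∩L≡1+∩X : All (λ V → ∣ proj₁ V ∩ proj₁ L ∣ ≡ suc ∣ proj₁ V ∩ X ∣) (U ∷ Us)
    ∩L≡1+∩X = All.map (λ {V} U⊆V → ∣∩∣-[]≔nothing (proj₁ V) (proj₁ L) i (U⊆V i c U∋ic) L∋ic)
                      (⊆ᶜ-refl {U} ∷ head⊆ᶜ-all U∷Us-incr)

    unique : ∀ S → T (meetsWithin U X S) → Fits (proj₁ S) Us → Fits (proj₁ L) (U ∷ Us) × proj₁ S ≡ X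
    unique S within (∣S∣≡1+k , S-steps) = (∣L∣≡2+k , L-steps) , S≡X
      where
      U∩S≠∅ = proj₁ (meetsWithin⁻ U X S within)
      S⊆X   = proj₂ (meetsWithin⁻ U X S within)

      S≡X : proj₁ S ≡ X
      S≡X = ⊆ᵛ-size-antisym (proj₁ S) X S⊆X (subst (size X ≤_) (sym ∣S∣≡1+k) ∣X∣≤1+k)

      ∣L∣≡2+k : size (proj₁ L) ≡ suc (suc (length Us))
      ∣L∣≡2+k = trans ∣L∣≡1+∣X∣ (cong suc (trans (cong size (sym S≡X)) ∣S∣≡1+k))

      L-steps : Staircase (λ V → ∣ proj₁ V ∩ proj₁ L ∣) 2 (U ∷ Us)
      L-steps = staircase-suc⁺ ∩L≡1+∩X
        ( subst (λ Y → 1 ≤ ∣ proj₁ U ∩ Y ∣) S≡X (meets⇒1≤∣∩∣ (proj₁ U) (proj₁ S) U∩S≠∅)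
        , subst (λ Y → Staircase (λ V → ∣ proj₁ V ∩ Y ∣) 2 Us) S≡X S-steps)

    exists : Fits (proj₁ L) (U ∷ Us) → Σ[ S ∈ Gen n r ] T (meetsWithin U X S) × Fits (proj₁ S) Us
    exists (∣L∣≡2+k , L-steps) with staircase-suc⁻ ∩L≡1+∩X L-steps
    ... | 1≤∣U∩X∣ , X-steps =
      (X , 1≤size⇒nonempty X (subst (1 ≤_) (sym ∣X∣≡1+k) (s≤s z≤n))) ,
      Equivalence.from T-∧
        (1≤∣∩∣⇒meets (proj₁ U) X 1≤∣U∩X∣ , Dec.fromWitness {a? = X ⊆ᵛ? X} (⊆ᵛ-refl {u = X})) ,
      (∣X∣≡1+k , X-steps)
      where
      ∣X∣≡1+k : size X ≡ suc (length Us)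
      ∣X∣≡1+k = ℕ.suc-injective (trans (sym ∣L∣≡1+∣X∣) ∣L∣≡2+k)

  ∑-hTerms-fits :
    (S₁ : Gen n r) (Us : List (Gen n r)) → suc (length Us) ≡ n → Linked _⊆ᶜ_ (S₁ ∷ Us) →
    ∑[ V ∈ hTerms S₁ ] indicator (fits? (proj₁ V) Us) ≡ indicator (staircase? (size ∘ proj₁) 1 (S₁ ∷ Us))
  ∑-hTerms-fits S₁ Us 1+k≡n S₁∷Us-incr =
    ∑-allGens-indicator-unique _ (λ V → fits? (proj₁ V) Us) (staircase? (size ∘ proj₁) 1 (S₁ ∷ Us))
      W unique exists
    where
    W = proj₁ (lastOf S₁ Us)

    ∩W≡size : All (λ U → ∣ proj₁ U ∩ W ∣ ≡ size (proj₁ U)) (S₁ ∷ Us)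
    ∩W≡size = All.map (λ {U} U⊆W → ⊆ᵛ⇒∣∩∣≡size (proj₁ U) W U⊆W) (all⊆ᶜ-lastOf S₁∷Us-incr)

    unique : ∀ V → T (meets (proj₁ S₁) (proj₁ V)) → Fits (proj₁ V) Us →
             Staircase (size ∘ proj₁) 1 (S₁ ∷ Us) × proj₁ V ≡ W
    unique V S₁∩V≠∅ (_ , V-steps) =
      staircase-cong ∩W≡size (subst (λ Y → Staircase (λ U → ∣ proj₁ U ∩ Y ∣) 1 (S₁ ∷ Us)) V≡W V-steps₁) ,
      V≡W
      where
      V-steps₁ : Staircase (λ U → ∣ proj₁ U ∩ proj₁ V ∣) 1 (S₁ ∷ Us)
      V-steps₁ = meets⇒1≤∣∩∣ (proj₁ S₁) (proj₁ V) S₁∩V≠∅ , V-steps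

      V≡W : proj₁ V ≡ W
      V≡W = sym (length≤∣∩∣⇒≡ W (proj₁ V)
                  (subst (_≤ ∣ W ∩ proj₁ V ∣) 1+k≡n (staircase-lastOf _ 1 S₁ Us V-steps₁)))

    exists : Staircase (size ∘ proj₁) 1 (S₁ ∷ Us) →
             Σ[ V ∈ Gen n r ] T (meets (proj₁ S₁) (proj₁ V)) × Fits (proj₁ V) Us
    exists sizes with staircase-cong (All.map sym ∩W≡size) sizes
    ... | 1≤∣S₁∩W∣ , W-steps =
      lastOf S₁ Us , 1≤∣∩∣⇒meets (proj₁ S₁) W 1≤∣S₁∩W∣ , ∣W∣≡1+k , W-steps
      where
      ∣W∣≡1+k : size W ≡ suc (length Us)
      ∣W∣≡1+k = ℕ.≤-antisym (subst (size W ≤_) (sym 1+k≡n) (size≤length W))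
                            (staircase-lastOf (size ∘ proj₁) 1 S₁ Us sizes)

-- Integrals against a degree map

module _ {n r : ℕ} (2≤r : 2 ≤ r) {φ : List (Gen n r) → ℤ} (φ-deg : IsDegreeMap n r φ) where
  open IsDegreeMap φ-deg

  φ-chain : (Ts : List (Gen n r)) → length Ts ≡ n → Linked _⊊ᶜ_ Ts → φ Ts ≡ 1ℤ
  φ-chain Ts ∣Ts∣≡n Ts-chain with toList-surjective Ts ∣Ts∣≡n
  ... | v , refl = chain-one v (Linked-toList⁻ v Ts-chain)

  φ-ʳ++-∷ : (Q : List (Gen n r)) (S : Gen n r) (m : List (Gen n r)) → length (Q ʳ++ S ∷ m) ≡ n →
            φ (Q ʳ++ S ∷ m) ≡ φ (S ∷ Q ʳ++ m)
  φ-ʳ++-∷ Q S m len = symmetric _ _ len (ʳ++-∷-↭ Q S m)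

  φ-hTerms≡φ-hTermsWithin :
    (L U : Gen n r) (i : Fin n) (c : Fin r) → L ∋[ i , c ] → U ∋[ i , c ] →
    (Q m : List (Gen n r)) → suc (suc (length Q Nat.+ length m)) ≡ n →
    ∑[ S ∈ hTerms U ] φ ((S ∷ L ∷ Q) ʳ++ m)
      ≡ ∑[ S ∈ hTermsWithin U (proj₁ L [ i ]≔ nothing) ] φ ((S ∷ L ∷ Q) ʳ++ m)
  φ-hTerms≡φ-hTermsWithin L U i c L∋ic U∋ic Q m len =
    ∑-hTerms≡∑-hTermsWithin _ L U i c L∋ic U∋ic incomparable 2≤r balanced
    where
    open ≡-Reasoning
    ∣LQm∣ : suc (length ((L ∷ Q) ʳ++ m)) ≡ n
    ∣LQm∣ = trans (cong suc (List.length-ʳ++ (L ∷ Q))) len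

    moved : ∀ S → φ ((S ∷ L ∷ Q) ʳ++ m) ≡ φ (S ∷ (L ∷ Q) ʳ++ m)
    moved S = φ-ʳ++-∷ (L ∷ Q) S m (trans (List.length-ʳ++ (S ∷ L ∷ Q)) len)

    incomparable : ∀ S → Incomparable S L → φ ((S ∷ L ∷ Q) ʳ++ m) ≡ 0ℤ
    incomparable S S∥L = begin
      φ ((S ∷ L ∷ Q) ʳ++ m)  ≡⟨ moved S ⟩
      φ (S ∷ Q ʳ++ L ∷ m)    ≡⟨ symmetric _ _ ∣LQm∣ (prep S (ʳ++-∷-↭ Q L m)) ⟩
      φ (S ∷ L ∷ Q ʳ++ m)    ≡⟨ vanish-I S L (Q ʳ++ m) (trans (cong (2 Nat.+_) (List.length-ʳ++ Q)) len) S∥L ⟩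
      0ℤ                     ∎

    balanced : ∀ a b → a ≢ b → ∑ (containing i a) (λ S → φ ((S ∷ L ∷ Q) ʳ++ m))
                               ≡ ∑ (containing i b) (λ S → φ ((S ∷ L ∷ Q) ʳ++ m))
    balanced a b a≢b = begin
      ∑ (containing i a) (λ S → φ ((S ∷ L ∷ Q) ʳ++ m))  ≡⟨ ∑-cong (containing i a) moved ⟩
      ∑ (containing i a) (λ S → φ (S ∷ (L ∷ Q) ʳ++ m))  ≡⟨ vanish-J ((L ∷ Q) ʳ++ m) ∣LQm∣ i a b a≢b ⟩
      ∑ (containing i b) (λ S → φ (S ∷ (L ∷ Q) ʳ++ m))  ≡⟨ sym (∑-cong (containing i b) moved) ⟩
      ∑ (containing i b) (λ S → φ ((S ∷ L ∷ Q) ʳ++ m))  ∎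

  -- ∫ x_Q h_{U₁} ⋯ h_{Uₖ}, with the variables of Q listed in reverse order of choice
  ∫xh : List (Gen n r) → List (Gen n r) → ℤ
  ∫xh Q Us = ∑[ m ∈ cartesian (map hTerms Us) ] φ (Q ʳ++ m)

  ∫xh-fits :
    (Us : List (Gen n r)) (L : Gen n r) (Q : List (Gen n r)) →
    length (L ∷ Q) Nat.+ length Us ≡ n → size (proj₁ L) ≤ suc (length Us) →
    Linked _⊊ᶜ_ (L ∷ Q) → Linked _⊆ᶜ_ Us → All (λ U → T (meets (proj₁ U) (proj₁ L))) Us →
    ∫xh (L ∷ Q) Us ≡ indicator (fits? (proj₁ L) Us)
  ∫xh-fits [] L Q len ∣L∣≤1 chain _ _ = begin
    φ (reverse (L ∷ Q)) + 0ℤ         ≡⟨ +-identityʳ _ ⟩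
    φ (reverse (L ∷ Q))              ≡⟨ symmetric _ _ ∣rev-LQ∣≡n (↭-reverse (L ∷ Q)) ⟩
    φ (L ∷ Q)                        ≡⟨ φ-chain (L ∷ Q) ∣LQ∣≡n chain ⟩
    1ℤ                               ≡⟨ sym (indicator-yes (fits? (proj₁ L) []) (∣L∣≡1 , tt)) ⟩
    indicator (fits? (proj₁ L) [])   ∎
    where
    open ≡-Reasoning
    ∣LQ∣≡n : length (L ∷ Q) ≡ n
    ∣LQ∣≡n = trans (sym (ℕ.+-identityʳ _)) len

    ∣rev-LQ∣≡n : length (reverse (L ∷ Q)) ≡ n
    ∣rev-LQ∣≡n = trans (List.length-reverse (L ∷ Q)) ∣LQ∣≡n

    ∣L∣≡1 : size (proj₁ L) ≡ 1
    ∣L∣≡1 = ℕ.≤-antisym ∣L∣≤1 (nonempty⇒1≤size (proj₁ L) (proj₂ L))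
  ∫xh-fits (U ∷ Us) L Q len ∣L∣≤2+k chain U∷Us-incr (U∩L≠∅ ∷ _)
    with meets⇒common (proj₁ U) (proj₁ L) U∩L≠∅
  ... | i , c , U∋ic , L∋ic = begin
    ∫xh (L ∷ Q) (U ∷ Us)
      ≡⟨ ∑-cartesian-∷ (hTerms U) (map hTerms Us) _ ⟩
    ∑[ S ∈ hTerms U ] ∫xh (S ∷ L ∷ Q) Us
      ≡⟨ ∑-comm (hTerms U) (cartesian (map hTerms Us)) _ ⟩
    ∑[ m ∈ cartesian (map hTerms Us) ] ∑[ S ∈ hTerms U ] φ ((S ∷ L ∷ Q) ʳ++ m)
      ≡⟨ ∑-cartesian-cong (map hTerms Us) (λ m ∣m∣ →
           φ-hTerms≡φ-hTermsWithin L U i c L∋ic U∋ic Q m (∣LQm∣≡n m ∣m∣)) ⟩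
    ∑[ m ∈ cartesian (map hTerms Us) ] ∑[ S ∈ hTermsWithin U X ] φ ((S ∷ L ∷ Q) ʳ++ m)
      ≡⟨ sym (∑-comm (hTermsWithin U X) (cartesian (map hTerms Us)) _) ⟩
    ∑[ S ∈ hTermsWithin U X ] ∫xh (S ∷ L ∷ Q) Us
      ≡⟨ ∑-filterᵇ-cong _ (allGens n r) (λ S within →
           ∫xh-fits Us S (L ∷ Q) ∣SLQ∣+k≡n (∣S∣≤1+k S within) (extend-chain S within)
             (Linked.tail U∷Us-incr) (meets-increasing U S Us U∷Us-incr (proj₁ (meetsWithin⁻ U X S within)))) ⟩
    ∑[ S ∈ hTermsWithin U X ] indicator (fits? (proj₁ S) Us)
      ≡⟨ ∑-hTermsWithin-fits L U i c L∋ic U∋ic Us U∷Us-incr ∣L∣≤2+k ⟩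
    indicator (fits? (proj₁ L) (U ∷ Us))
      ∎
    where
    open ≡-Reasoning
    X = proj₁ L [ i ]≔ nothing

    ∣SLQ∣+k≡n : suc (suc (length Q Nat.+ length Us)) ≡ n
    ∣SLQ∣+k≡n = trans (cong suc (sym (ℕ.+-suc (length Q) (length Us)))) len

    ∣LQm∣≡n : ∀ m → length m ≡ length (map hTerms Us) → suc (suc (length Q Nat.+ length m)) ≡ n
    ∣LQm∣≡n m ∣m∣ = subst (λ k → suc (suc (length Q Nat.+ k)) ≡ n)
                          (sym (trans ∣m∣ (List.length-map hTerms Us))) ∣SLQ∣+k≡n

    module _ (S : Gen n r) (within : T (meetsWithin U X S)) where
      S⊆X : proj₁ S ⊆ᵛ X
      S⊆X = proj₂ (meetsWithin⁻ U X S within)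

      ∣S∣≤1+k : size (proj₁ S) ≤ suc (length Us)
      ∣S∣≤1+k = ℕ.≤-trans (⊆ᵛ⇒size≤ (proj₁ S) X S⊆X)
                  (ℕ.≤-pred (subst (_≤ suc (suc (length Us))) (size-[]≔nothing (proj₁ L) i L∋ic) ∣L∣≤2+k))

      extend-chain : Linked _⊊ᶜ_ (S ∷ L ∷ Q)
      extend-chain =
        ( ⊆ᵛ-trans {u = proj₁ S} {X} {proj₁ L} S⊆X ([]≔nothing-⊆ᵛ (proj₁ L) i)
        , λ L⊆S → ⊆ᵛ-[]≔nothing⁻ {u = proj₁ S} {proj₁ L} S⊆X (L⊆S i c L∋ic)) ∷ chain

  ∫h-increasing : (Us : List (Gen n r)) → length Us ≡ n → Linked _⊆ᶜ_ Us →
                  ∫h φ Us ≡ indicator (staircase? (size ∘ proj₁) 1 Us)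
  ∫h-increasing []        ∣Us∣≡n _          = trans (+-identityʳ _) (φ-chain [] ∣Us∣≡n [])
  ∫h-increasing (S₁ ∷ Us) ∣Us∣≡n S₁∷Us-incr = begin
    ∫h φ (S₁ ∷ Us)
      ≡⟨ ∑-cartesian-∷ (hTerms S₁) (map hTerms Us) φ ⟩
    ∑[ V ∈ hTerms S₁ ] ∫xh [ V ] Us
      ≡⟨ ∑-filterᵇ-cong _ (allGens n r) (λ V S₁∩V≠∅ →
           ∫xh-fits Us V [] ∣Us∣≡n (∣V∣≤1+k V) [-] (Linked.tail S₁∷Us-incr)
             (meets-increasing S₁ V Us S₁∷Us-incr S₁∩V≠∅)) ⟩
    ∑[ V ∈ hTerms S₁ ] indicator (fits? (proj₁ V) Us)
      ≡⟨ ∑-hTerms-fits S₁ Us ∣Us∣≡n S₁∷Us-incr ⟩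
    indicator (staircase? (size ∘ proj₁) 1 (S₁ ∷ Us))
      ∎
    where
    open ≡-Reasoning
    ∣V∣≤1+k : ∀ V → size (proj₁ V) ≤ suc (length Us)
    ∣V∣≤1+k V = subst (size (proj₁ V) ≤_) (sym ∣Us∣≡n) (size≤length (proj₁ V))

proposition6p9 : (n r : ℕ) → 2 ≤ r →
    (φ : List (Gen n r) → ℤ) → IsDegreeMap n r φ →
    (Ss : Vec (Gen n r) n) →
    ((k k' : Fin n) → toℕ k' ≡ suc (toℕ k) → lookup Ss k ⊆ᶜ lookup Ss k') →
    (((k : Fin n) → suc (toℕ k) ≤ size (proj₁ (lookup Ss k))) → ∫h φ (toList Ss) ≡ 1ℤ)
    × (¬ ((k : Fin n) → suc (toℕ k) ≤ size (proj₁ (lookup Ss k))) → ∫h φ (toList Ss) ≡ 0ℤ)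
proposition6p9 n r 2≤r φ φ-deg Ss Ss-increasing = sizes⇒1 , ¬sizes⇒0
  where
  ∫h≡indicator : ∫h φ (toList Ss) ≡ indicator (staircase? (size ∘ proj₁) 1 (toList Ss))
  ∫h≡indicator = ∫h-increasing 2≤r φ-deg (toList Ss) (length-toList Ss) (Linked-toList⁺ Ss Ss-increasing)

  sizes⇒1 : ((k : Fin n) → suc (toℕ k) ≤ size (proj₁ (lookup Ss k))) → ∫h φ (toList Ss) ≡ 1ℤ
  sizes⇒1 sizes = trans ∫h≡indicator (indicator-yes _ (staircase-toList⁺ (size ∘ proj₁) 1 Ss sizes))

  ¬sizes⇒0 : ¬ ((k : Fin n) → suc (toℕ k) ≤ size (proj₁ (lookup Ss k))) → ∫h φ (toList Ss) ≡ 0ℤ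
  ¬sizes⇒0 ¬sizes = trans ∫h≡indicator (indicator-no _ (¬sizes ∘ staircase-toList⁻ (size ∘ proj₁) 1 Ss))
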